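{- Let $\gamma,\varepsilon>0$ be real constants and let $r\in\mathbb{N}$. Then there exist a real constant $\alpha>0$ and $n_0\in\mathbb{N}$ such that for all integers $n\geq n_0$ and all $n$-vertex graphs $G=(V,E)$ with $|E|\geq\gamma n^2$ the following holds: if $G[U]\rightarrow(K_{\lceil r/2\rceil},K_r)$ for all subsets $U\subseteq V$ with $|U|\geq\alpha n$, and $G[U]\rightarrow(K_{\lfloor r/2\rfloor},K_r)$ for all subsets $U\subseteq V$ with $|U|\geq n^{1-\varepsilon}$, then $G\rightarrow(K_r)$.
   Context: $G[U]$ is the subgraph induced by $U$. For graphs $G,H_1,H_2$, $G\rightarrow(H_1,H_2)$ means that every colouring of $E(G)$ with colours $1,2$ contains a copy of $H_1$ all of whose edges have colour $1$ or a copy of $H_2$ all of whose edges have colour $2$. $G\rightarrow(K_r)$ means $G\rightarrow(K_r,K_r)$, i.e. every 2-colouring of $E(G)$ has a monochromatic $K_r$.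
   Formalization: The constants γ and ε range over the positive rationals instead of the positive reals, and the constant α is given as a positive rational. -}

module Defs where

open import Data.Nat using (ℕ; zero; suc; _+_; _*_; _^_; _≤_; _<_; _<ᵇ_; NonZero)
open import Data.Nat.ListAction using (sum)
open import Data.Bool using (Bool; true; false; if_then_else_; _∧_)
open import Data.Fin using (Fin; toℕ)
open import Data.Fin.Subset using (Subset; _∈_; ∣_∣)
open import Data.List using (List; map; allFin)
open import Data.Product using (Σ; ∃; _×_; _,_)
open import Data.Sum using (_⊎_)
open import Relation.Binary.PropositionalEquality using (_≡_; _≢_)
open import Function.Definitions using (Injective)

record Graph (n : ℕ) : Set where
  field
    adj   : Fin n → Fin n → Bool
    sym   : ∀ i j → adj i j ≡ adj j i
    loopless : ∀ i → adj i i ≡ false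
open Graph public

edgeCount : ∀ {n} → Graph n → ℕ
edgeCount {n} G =
  sum (map (λ i → sum (map (λ j → if (toℕ i <ᵇ toℕ j) ∧ adj G i j then 1 else 0)
                           (allFin n)))
           (allFin n))

-- A 2-colouring of the edges of G: a colour for every unordered pair
-- (only values on edges matter). Colour 1 = true, colour 2 = false.
record Colouring (n : ℕ) : Set where
  field
    col    : Fin n → Fin n → Bool
    colSym : ∀ i j → col i j ≡ col j i
open Colouring public

MonoClique : ∀ {n} → Graph n → Subset n → Colouring n → Bool → ℕ → Set
MonoClique {n} G U c b k =
  Σ (Fin k → Fin n) λ f →
      Injective _≡_ _≡_ f
    × (∀ i → f i ∈ U)
    × (∀ i j → i ≢ j → (adj G (f i) (f j) ≡ true) × (col c (f i) (f j) ≡ b))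

-- G[U] → (K_s , K_t): every 2-colouring of the edges of G[U] has a
-- colour-1 K_s or a colour-2 K_t.  (Colourings of E(G[U]) are exactly
-- restrictions of colourings of pairs of V.)
Arrows : ∀ {n} → Graph n → Subset n → ℕ → ℕ → Set
Arrows G U s t = ∀ (c : Colouring _) → MonoClique G U c true s ⊎ MonoClique G U c false t

{-# OPTIONS --safe #-}
-- Dependent random choice.  Write γ = a/b ≥ 1/b, ε = p/q, t = ⌈r/2⌉, s = ⌊r/2⌋ and h = q t.  In a
-- 2-colouring one colour, say red, carries half of the edges, and counting the vertices of red degree
-- at least n/4b gives Σ_v deg(v)^h ≥ n^(h+1)/(4b)^(h+1).  Average over all h-tuples x of vertices:
-- the common red neighbourhood N(x) has mean size Σ_v deg(v)^h / n^h, whereas a t-tuple y whose own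
-- common neighbourhood has fewer than n^(1-ε) vertices lies inside N(x) for a fraction
-- (|N(y)|/n)^h < n^(-pt) of the x only, so on average at most one such sparse t-tuple lies in N(x).
-- For a good x, deleting one vertex of each sparse t-tuple in N(x) leaves a set A of at least αn
-- vertices, α = 1/(2(4b)^(h+1)), containing no sparse t-tuple.  So A contains a blue K_r or a red
-- K_t, and then the common neighbourhood of that K_t has at least n^(1-ε) vertices and contains a
-- blue K_r or a red K_s, which together with the K_t forms a red K_r.
module Submission where

open import Algebra.Bundles using (CommutativeMonoid)
open import Data.Bool using (Bool; true; false; _∧_; not; T; if_then_else_)
open import Data.Bool.Properties using (∧-commutativeMonoid; T-∧; T-≡; not-involutive)
open import Data.Empty using (⊥-elim)
open import Data.Fin using (Fin; zero; suc; toℕ; splitAt; join)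
open import Data.Fin.Properties using (join-splitAt)
open import Data.Fin.Subset using (Subset; _∈_; ∣_∣; ⊤)
open import Data.Fin.Subset.Properties using (∈⊤)
import Data.List as List using (map; allFin; tabulate)
open import Data.List.Properties using (map-tabulate)
open import Data.Nat
  using (ℕ; zero; suc; _+_; _*_; _^_; _≤_; _<_; _<ᵇ_; _≤ᵇ_; _≡ᵇ_; z≤n; s≤s; NonZero; >-nonZero; ⌈_/2⌉; ⌊_/2⌋)
import Data.Nat.ListAction as List using (sum)
open import Data.Nat.Properties
open import Data.Nat.Tactic.RingSolver using (solve-∀)
open import Data.Product using (Σ; ∃; _×_; _,_; proj₁; proj₂)
open import Data.Sum using (_⊎_; inj₁; inj₂; [_,_]′; map; map₁; swap)
open import Data.Vec using (Vec; []; _∷_; tabulate)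
open import Data.Vec.Functional using (_++_)
open import Data.Vec.Properties using (lookup∘tabulate; []=⇒lookup)
open import Function using (_∘_; id)
open import Function.Bundles using (Equivalence)
open import Function.Definitions using (Injective)
open import Relation.Binary.PropositionalEquality
  using (_≡_; _≢_; refl; sym; trans; cong; cong₂; subst; module ≡-Reasoning)
open import Relation.Nullary using (yes; no; ¬_)

open import Defs hiding (sym)

open import Algebra.Properties.Semiring.Sum +-*-semiring
  using (sum; sum-syntax; sum-cong-≗; ∑-distrib-+; ∑-comm; *-distribˡ-sum; *-distribʳ-sum)
open import Algebra.Properties.CommutativeSemigroup
  (CommutativeMonoid.commutativeSemigroup ∧-commutativeMonoid)
  using () renaming (interchange to ∧-interchange)
open import Algebra.Properties.CommutativeSemigroup *-commutativeSemigroup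
  using () renaming (interchange to *-interchange)
open Equivalence using (to; from)

-- Finite sums

∑-const : ∀ n k → ∑[ i < n ] k ≡ n * k
∑-const zero    k = refl
∑-const (suc n) k = cong (k +_) (∑-const n k)

∑-mono-≤ : ∀ {n} {f g : Fin n → ℕ} → (∀ i → f i ≤ g i) → sum f ≤ sum g
∑-mono-≤ {zero}  f≤g = z≤n
∑-mono-≤ {suc n} f≤g = +-mono-≤ (f≤g zero) (∑-mono-≤ (f≤g ∘ suc))

f≤∑f : ∀ {n} (f : Fin n → ℕ) i → f i ≤ sum f
f≤∑f f zero    = m≤m+n (f zero) _
f≤∑f f (suc i) = ≤-trans (f≤∑f (f ∘ suc) i) (m≤n+m _ (f zero))

∑-<⇒∃< : ∀ {n} (f g : Fin n → ℕ) → sum f < sum g → ∃ λ i → f i < g i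
∑-<⇒∃< {suc n} f g ∑f<∑g with f zero <? g zero
... | yes f₀<g₀ = zero , f₀<g₀
... | no  f₀≮g₀ with ∑-<⇒∃< (f ∘ suc) (g ∘ suc)
                      (+-cancelˡ-< (g zero) _ _ (≤-<-trans (+-monoˡ-≤ _ (≮⇒≥ f₀≮g₀)) ∑f<∑g))
...   | i , fᵢ<gᵢ = suc i , fᵢ<gᵢ

listSum-allFin : ∀ n (f : Fin n → ℕ) → List.sum (List.map f (List.allFin n)) ≡ sum f
listSum-allFin n f = trans (cong List.sum (map-tabulate id f)) (listSum-tabulate n f)
  where
  listSum-tabulate : ∀ n (f : Fin n → ℕ) → List.sum (List.tabulate f) ≡ sum f
  listSum-tabulate zero    f = refl
  listSum-tabulate (suc n) f = cong (f zero +_) (listSum-tabulate n (f ∘ suc))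

∑ᵗ : ∀ {n} h → (Vec (Fin n) h → ℕ) → ℕ
∑ᵗ zero        f = f []
∑ᵗ {n} (suc h) f = ∑[ v < n ] ∑ᵗ h (f ∘ (v ∷_))

∑ᵗ-cong : ∀ {n} h {f g : Vec (Fin n) h → ℕ} → (∀ x → f x ≡ g x) → ∑ᵗ h f ≡ ∑ᵗ h g
∑ᵗ-cong zero    f≗g = f≗g []
∑ᵗ-cong (suc h) f≗g = sum-cong-≗ λ v → ∑ᵗ-cong h (f≗g ∘ (v ∷_))

∑ᵗ-mono-≤ : ∀ {n} h {f g : Vec (Fin n) h → ℕ} → (∀ x → f x ≤ g x) → ∑ᵗ h f ≤ ∑ᵗ h g
∑ᵗ-mono-≤ zero    f≤g = f≤g []
∑ᵗ-mono-≤ (suc h) f≤g = ∑-mono-≤ λ v → ∑ᵗ-mono-≤ h (f≤g ∘ (v ∷_))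

∑ᵗ-distrib-+ : ∀ {n} h (f g : Vec (Fin n) h → ℕ) →
               ∑ᵗ h (λ x → f x + g x) ≡ ∑ᵗ h f + ∑ᵗ h g
∑ᵗ-distrib-+ zero    f g = refl
∑ᵗ-distrib-+ (suc h) f g =
  trans (sum-cong-≗ λ v → ∑ᵗ-distrib-+ h (f ∘ (v ∷_)) (g ∘ (v ∷_)))
        (∑-distrib-+ (λ v → ∑ᵗ h (f ∘ (v ∷_))) (λ v → ∑ᵗ h (g ∘ (v ∷_))))

*-distribˡ-∑ᵗ : ∀ {n} h k (f : Vec (Fin n) h → ℕ) → k * ∑ᵗ h f ≡ ∑ᵗ h (λ x → k * f x)
*-distribˡ-∑ᵗ zero    k f = refl
*-distribˡ-∑ᵗ (suc h) k f =
  trans (*-distribˡ-sum k λ v → ∑ᵗ h (f ∘ (v ∷_))) (sum-cong-≗ λ v → *-distribˡ-∑ᵗ h k (f ∘ (v ∷_)))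

∑ᵗ-const : ∀ {n} h k → ∑ᵗ {n} h (λ _ → k) ≡ n ^ h * k
∑ᵗ-const zero        k = sym (+-identityʳ k)
∑ᵗ-const {n} (suc h) k = begin
  ∑[ v < n ] ∑ᵗ h (λ _ → k) ≡⟨ sum-cong-≗ {n} (λ _ → ∑ᵗ-const h k) ⟩
  ∑[ v < n ] (n ^ h * k)    ≡⟨ ∑-const n _ ⟩
  n * (n ^ h * k)           ≡⟨ *-assoc n (n ^ h) k ⟨
  n ^ suc h * k             ∎
  where open ≡-Reasoning

∑ᵗ-∑-comm : ∀ {n m} h (F : Vec (Fin n) h → Fin m → ℕ) →
            ∑ᵗ h (λ x → ∑[ j < m ] F x j) ≡ ∑[ j < m ] ∑ᵗ h (λ x → F x j)
∑ᵗ-∑-comm zero    F = refl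
∑ᵗ-∑-comm (suc h) F =
  trans (sum-cong-≗ λ v → ∑ᵗ-∑-comm h (F ∘ (v ∷_))) (∑-comm λ v j → ∑ᵗ h (λ x → F (v ∷ x) j))

∑ᵗ-comm : ∀ {n} h t (F : Vec (Fin n) h → Vec (Fin n) t → ℕ) →
          ∑ᵗ h (λ x → ∑ᵗ t (F x)) ≡ ∑ᵗ t (λ y → ∑ᵗ h (λ x → F x y))
∑ᵗ-comm zero    t F = refl
∑ᵗ-comm (suc h) t F =
  trans (sum-cong-≗ λ v → ∑ᵗ-comm h t (F ∘ (v ∷_))) (sym (∑ᵗ-∑-comm t λ y v → ∑ᵗ h (λ x → F (v ∷ x) y)))

f≤∑ᵗf : ∀ {n} h (f : Vec (Fin n) h → ℕ) x → f x ≤ ∑ᵗ h f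
f≤∑ᵗf zero    f []      = ≤-refl
f≤∑ᵗf (suc h) f (v ∷ x) = ≤-trans (f≤∑ᵗf h (f ∘ (v ∷_)) x) (f≤∑f _ v)

∑ᵗ-<⇒∃< : ∀ {n} h (f g : Vec (Fin n) h → ℕ) → ∑ᵗ h f < ∑ᵗ h g → ∃ λ x → f x < g x
∑ᵗ-<⇒∃< zero    f g f<g = [] , f<g
∑ᵗ-<⇒∃< (suc h) f g ∑f<∑g with ∑-<⇒∃< _ _ ∑f<∑g
... | v , ∑fᵥ<∑gᵥ with ∑ᵗ-<⇒∃< h (f ∘ (v ∷_)) (g ∘ (v ∷_)) ∑fᵥ<∑gᵥ
...   | x , fₓ<gₓ = v ∷ x , fₓ<gₓ

-- Counting with Boolean predicates

[_] : Bool → ℕ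
[ true  ] = 1
[ false ] = 0

[]-∧ : ∀ a b → [ a ∧ b ] ≡ [ a ] * [ b ]
[]-∧ true  b = sym (+-identityʳ [ b ])
[]-∧ false b = refl

[]≤1 : ∀ a → [ a ] ≤ 1
[]≤1 true  = ≤-refl
[]≤1 false = z≤n

infix 10 #_
#_ : ∀ {n} → (Fin n → Bool) → ℕ
#_ {n} P = ∑[ v < n ] [ P v ]

all : ∀ {A : Set} {k} → (A → Bool) → Vec A k → Bool
all P []      = true
all P (u ∷ x) = P u ∧ all P x

all-const-true : ∀ {A : Set} {k} (x : Vec A k) → all (λ _ → true) x ≡ true
all-const-true []      = refl
all-const-true (u ∷ x) = all-const-true x

all-∧ : ∀ {A : Set} {k} (P Q : A → Bool) (x : Vec A k) →
        all (λ u → P u ∧ Q u) x ≡ all P x ∧ all Q x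
all-∧ P Q []      = refl
all-∧ P Q (u ∷ x) = trans (cong ((P u ∧ Q u) ∧_) (all-∧ P Q x)) (∧-interchange (P u) (Q u) _ _)

all-cong : ∀ {A : Set} {k} {P Q : A → Bool} → (∀ u → P u ≡ Q u) → (x : Vec A k) → all P x ≡ all Q x
all-cong P≗Q []      = refl
all-cong P≗Q (u ∷ x) = cong₂ _∧_ (P≗Q u) (all-cong P≗Q x)

all-comm : ∀ {A B : Set} {h t} (R : A → B → Bool) (x : Vec A h) (y : Vec B t) →
           all (λ w → all (λ u → R u w) x) y ≡ all (λ u → all (R u) y) x
all-comm R []      y = all-const-true y
all-comm R (u ∷ x) y = trans (all-∧ (R u) _ y) (cong (all (R u) y ∧_) (all-comm R x y))

∑ᵗ-all : ∀ {n} h (P : Fin n → Bool) → ∑ᵗ h (λ x → [ all P x ]) ≡ # P ^ h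
∑ᵗ-all zero        P = refl
∑ᵗ-all {n} (suc h) P = begin
  ∑[ v < n ] ∑ᵗ h (λ x → [ P v ∧ all P x ])       ≡⟨ sum-cong-≗ {n} (λ v → ∑ᵗ-cong h ([]-∧ (P v) ∘ all P)) ⟩
  ∑[ v < n ] ∑ᵗ h (λ x → [ P v ] * [ all P x ])   ≡⟨ sum-cong-≗ {n} (λ v → *-distribˡ-∑ᵗ h [ P v ] _) ⟨
  ∑[ v < n ] ([ P v ] * ∑ᵗ h (λ x → [ all P x ])) ≡⟨ *-distribʳ-sum (∑ᵗ h (λ x → [ all P x ])) ([_] ∘ P) ⟨
  # P * ∑ᵗ h (λ x → [ all P x ])                  ≡⟨ cong (# P *_) (∑ᵗ-all h P) ⟩
  # P * # P ^ h                                   ∎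
  where open ≡-Reasoning

all-mono : ∀ {A : Set} {k} {P Q : A → Bool} → (∀ u → T (P u) → T (Q u)) →
           (x : Vec A k) → T (all P x) → T (all Q x)
all-mono P⇒Q []      _   = _
all-mono P⇒Q (u ∷ x) Pux = let Pu , Px = to T-∧ Pux in from T-∧ (P⇒Q u Pu , all-mono P⇒Q x Px)

[]≡1 : ∀ {b} → T b → [ b ] ≡ 1
[]≡1 {true} _ = refl

∣tabulate∣≡# : ∀ {n} (P : Fin n → Bool) → ∣ tabulate P ∣ ≡ # P
∣tabulate∣≡# {zero}  P = refl
∣tabulate∣≡# {suc n} P with P zero
... | true  = cong suc (∣tabulate∣≡# (P ∘ suc))
... | false = ∣tabulate∣≡# (P ∘ suc)

∈tabulate⇒T : ∀ {n} (P : Fin n → Bool) {v} → v ∈ tabulate P → T (P v)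
∈tabulate⇒T P {v} v∈P = from T-≡ (trans (sym (lookup∘tabulate P v)) ([]=⇒lookup v∈P))

all-tabulate⁺ : ∀ {A : Set} {k} (P : A → Bool) (f : Fin k → A) →
                (∀ i → T (P (f i))) → T (all P (tabulate f))
all-tabulate⁺ {k = zero}  P f Pf = _
all-tabulate⁺ {k = suc k} P f Pf = from T-∧ (Pf zero , all-tabulate⁺ P (f ∘ suc) (Pf ∘ suc))

all-tabulate⁻ : ∀ {A : Set} {k} (P : A → Bool) (f : Fin k → A) →
                T (all P (tabulate f)) → ∀ i → T (P (f i))
all-tabulate⁻ {k = suc k} P f Pf zero    = proj₁ (to (T-∧ {P (f zero)}) Pf)
all-tabulate⁻ {k = suc k} P f Pf (suc i) = all-tabulate⁻ P (f ∘ suc) (proj₂ (to (T-∧ {P (f zero)}) Pf)) i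

^-distribʳ-* : ∀ m n k → (m * n) ^ k ≡ m ^ k * n ^ k
^-distribʳ-* m n zero    = refl
^-distribʳ-* m n (suc k) = begin
  m * n * (m * n) ^ k       ≡⟨ cong (m * n *_) (^-distribʳ-* m n k) ⟩
  m * n * (m ^ k * n ^ k)   ≡⟨ *-interchange m n (m ^ k) (n ^ k) ⟩
  m * m ^ k * (n * n ^ k)   ∎
  where open ≡-Reasoning

many-large-values : ∀ n M (f : Fin n → ℕ) → (∀ v → f v ≤ n) → 2 * (n * n) ≤ M * sum f →
                    n ≤ M * # (λ v → n ≤ᵇ M * f v)
many-large-values zero      M f f≤n _       = z≤n
many-large-values n@(suc _) M f f≤n 2n²≤M∑f =
  *-cancelʳ-≤ n (M * # large) n (+-cancelʳ-≤ (n * n) (n * n) (M * # large * n) (begin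
    n * n + n * n                            ≡⟨ cong (n * n +_) (+-identityʳ (n * n)) ⟨
    2 * (n * n)                              ≤⟨ 2n²≤M∑f ⟩
    M * sum f                                ≡⟨ *-distribˡ-sum M f ⟩
    ∑[ v < n ] (M * f v)                     ≤⟨ ∑-mono-≤ Mf≤[large]Mn+n ⟩
    ∑[ v < n ] ([ large v ] * (M * n) + n)   ≡⟨ ∑-distrib-+ (λ v → [ large v ] * (M * n)) (λ _ → n) ⟩
    ∑[ v < n ] ([ large v ] * (M * n)) + ∑[ v < n ] n
                                             ≡⟨ cong₂ _+_ (sym (*-distribʳ-sum (M * n) ([_] ∘ large))) (∑-const n n) ⟩
    # large * (M * n) + n * n                ≡⟨ cong (_+ n * n) (*-assoc (# large) M n) ⟨
    # large * M * n + n * n                  ≡⟨ cong (λ m → m * n + n * n) (*-comm (# large) M) ⟩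
    M * # large * n + n * n                  ∎))
  where
  open ≤-Reasoning
  large : Fin n → Bool
  large v = n ≤ᵇ M * f v
  Mf≤[large]Mn+n : ∀ v → M * f v ≤ [ large v ] * (M * n) + n
  Mf≤[large]Mn+n v with large v in n≤ᵇMf
  ... | true  = ≤-trans (*-monoʳ-≤ M (f≤n v)) (≤-trans (≤-reflexive (sym (*-identityˡ (M * n)))) (m≤m+n _ n))
  ... | false = <⇒≤ (≰⇒> (λ n≤Mf → subst T n≤ᵇMf (≤⇒≤ᵇ n≤Mf)))

power-sum-lower-bound : ∀ n M h (f : Fin n → ℕ) → (∀ v → f v ≤ n) → 2 * (n * n) ≤ M * sum f →
                        n ^ suc h ≤ M ^ suc h * ∑[ v < n ] (f v ^ h)
power-sum-lower-bound n M h f f≤n 2n²≤M∑f = begin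
  n * n ^ h                                  ≤⟨ *-monoˡ-≤ (n ^ h) (many-large-values n M f f≤n 2n²≤M∑f) ⟩
  M * # large * n ^ h                        ≡⟨ *-assoc M (# large) (n ^ h) ⟩
  M * (# large * n ^ h)                      ≡⟨ cong (M *_) (*-distribʳ-sum (n ^ h) (λ v → [ large v ])) ⟩
  M * ∑[ v < n ] ([ large v ] * n ^ h)       ≤⟨ *-monoʳ-≤ M (∑-mono-≤ [large]*n^h≤) ⟩
  M * ∑[ v < n ] (M ^ h * f v ^ h)           ≡⟨ cong (M *_) (*-distribˡ-sum (M ^ h) (λ v → f v ^ h)) ⟨
  M * (M ^ h * ∑[ v < n ] (f v ^ h))         ≡⟨ *-assoc M (M ^ h) _ ⟨
  M ^ suc h * ∑[ v < n ] (f v ^ h)           ∎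
  where
  open ≤-Reasoning
  large : Fin n → Bool
  large v = n ≤ᵇ M * f v
  [large]*n^h≤ : ∀ v → [ large v ] * n ^ h ≤ M ^ h * f v ^ h
  [large]*n^h≤ v with large v in n≤ᵇMf
  ... | false = z≤n
  ... | true  = begin
    1 * n ^ h      ≡⟨ *-identityˡ (n ^ h) ⟩
    n ^ h          ≤⟨ ^-monoˡ-≤ h (≤ᵇ⇒≤ n (M * f v) (subst T (sym n≤ᵇMf) _)) ⟩
    (M * f v) ^ h  ≡⟨ ^-distribʳ-* M (f v) h ⟩
    M ^ h * f v ^ h ∎

-- Common neighbourhoods

module CommonNeighbourhood {n} (R : Fin n → Fin n → Bool) where

  N : ∀ {k} → Vec (Fin n) k → Fin n → Bool
  N x v = all (λ u → R u v) x

  degree : Fin n → ℕ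
  degree v = # (λ u → R u v)

  #N[]≡n : # N [] ≡ n
  #N[]≡n = trans (∑-const n 1) (*-identityʳ n)

  degree≤n : ∀ v → degree v ≤ n
  degree≤n v = ≤-trans (∑-mono-≤ (λ u → []≤1 (R u v))) (≤-reflexive #N[]≡n)

  ∑ᵗ-#N : ∀ h → ∑ᵗ h (λ x → # N x) ≡ ∑[ v < n ] (degree v ^ h)
  ∑ᵗ-#N h = trans (∑ᵗ-∑-comm h λ x v → [ N x v ]) (sum-cong-≗ {n} λ v → ∑ᵗ-all h (λ u → R u v))

  ∑ᵗ-count-in-N : (∀ u v → R u v ≡ R v u) → ∀ h t (B : Vec (Fin n) t → Bool) →
                  ∑ᵗ h (λ x → ∑ᵗ t (λ y → [ B y ∧ all (N x) y ])) ≡ ∑ᵗ t (λ y → [ B y ] * # N y ^ h)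
  ∑ᵗ-count-in-N R-sym h t B = trans (∑ᵗ-comm h t _) (∑ᵗ-cong t count-for)
    where
    y⊆Nx≡x⊆Ny : ∀ (x : Vec (Fin n) h) (y : Vec (Fin n) t) → all (N x) y ≡ all (N y) x
    y⊆Nx≡x⊆Ny x y = trans (all-comm R x y) (all-cong (λ u → all-cong (R-sym u) y) x)
    count-for : ∀ y → ∑ᵗ h (λ x → [ B y ∧ all (N x) y ]) ≡ [ B y ] * # N y ^ h
    count-for y = begin
      ∑ᵗ h (λ x → [ B y ∧ all (N x) y ])      ≡⟨ ∑ᵗ-cong h (λ x → []-∧ (B y) (all (N x) y)) ⟩
      ∑ᵗ h (λ x → [ B y ] * [ all (N x) y ])  ≡⟨ ∑ᵗ-cong h (λ x → cong (λ b → [ B y ] * [ b ]) (y⊆Nx≡x⊆Ny x y)) ⟩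
      ∑ᵗ h (λ x → [ B y ] * [ all (N y) x ])  ≡⟨ *-distribˡ-∑ᵗ h [ B y ] _ ⟨
      [ B y ] * ∑ᵗ h (λ x → [ all (N y) x ])  ≡⟨ cong ([ B y ] *_) (∑ᵗ-all h (N y)) ⟩
      [ B y ] * # N y ^ h                     ∎
      where open ≡-Reasoning

-- The hypothesis only matters for t = 0: the empty tuple lies in every set, so no deletion removes it.
delete-bad-tuples : ∀ {n} t (B : Vec (Fin n) t → Bool) →
                    (∀ y → T (all (λ _ → false) y) → ¬ T (B y)) → (A : Fin n → Bool) →
                    Σ (Fin n → Bool) λ A′ →
                      # A ≤ # A′ + ∑ᵗ t (λ y → [ B y ∧ all A y ]) × (∀ y → T (all A′ y) → ¬ T (B y))
delete-bad-tuples zero B ∅-good A = A , m≤m+n (# A) _ , λ { [] _ → ∅-good [] _ }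
delete-bad-tuples {n} (suc t) B _ A = A′ , #A≤#A′+bad , A′-good
  where
  bad-from : Fin n → ℕ
  bad-from v = ∑ᵗ t (λ y → [ B (v ∷ y) ∧ all A (v ∷ y) ])

  A′ : Fin n → Bool
  A′ v = A v ∧ (bad-from v ≡ᵇ 0)

  [A]≤[A′]+bad : ∀ v → [ A v ] ≤ [ A′ v ] + bad-from v
  [A]≤[A′]+bad v with A v | bad-from v
  ... | false | _     = z≤n
  ... | true  | zero  = ≤-refl
  ... | true  | suc _ = s≤s z≤n

  #A≤#A′+bad : # A ≤ # A′ + ∑[ v < n ] bad-from v
  #A≤#A′+bad = ≤-trans (∑-mono-≤ [A]≤[A′]+bad) (≤-reflexive (∑-distrib-+ (λ v → [ A′ v ]) bad-from))

  A′-good : ∀ y → T (all A′ y) → ¬ T (B y)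
  A′-good (v ∷ y) A′vy Bvy = n≮0 (begin-strict
    0                             <⟨ s≤s z≤n ⟩
    1                             ≡⟨ []≡1 (from T-∧ (Bvy , Avy)) ⟨
    [ B (v ∷ y) ∧ all A (v ∷ y) ] ≤⟨ f≤∑ᵗf t (λ y → [ B (v ∷ y) ∧ all A (v ∷ y) ]) y ⟩
    bad-from v                    ≡⟨ ≡ᵇ⇒≡ (bad-from v) 0 (proj₂ (to (T-∧ {A v}) A′v)) ⟩
    0                             ∎)
    where
    open ≤-Reasoning
    A′v : T (A′ v)
    A′v = proj₁ (to (T-∧ {A′ v}) A′vy)
    Avy : T (all A (v ∷ y))
    Avy = all-mono (λ u → proj₁ ∘ to T-∧) (v ∷ y) A′vy

-- Cliques and colourings

Joined : ∀ {n} → Graph n → Colouring n → Bool → Fin n → Fin n → Set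
Joined G c b u v = adj G u v ≡ true × col c u v ≡ b

Joined-sym : ∀ {n} (G : Graph n) {c b u v} → Joined G c b u v → Joined G c b v u
Joined-sym G {c} {u = u} {v} (uv∈G , cuv≡b) = trans (Graph.sym G v u) uv∈G , trans (colSym c v u) cuv≡b

Joined-irrefl : ∀ {n} (G : Graph n) {c b v} → ¬ Joined G c b v v
Joined-irrefl G {v = v} (vv∈G , _) with () ← trans (sym vv∈G) (loopless G v)

MonoClique-map : ∀ {n} {G : Graph n} {U U′ c c′ b b′ k} → (∀ {v} → v ∈ U → v ∈ U′) →
                 (∀ u v → col c u v ≡ b → col c′ u v ≡ b′) →
                 MonoClique G U c b k → MonoClique G U′ c′ b′ k
MonoClique-map U⊆U′ recolour (f , f-inj , f∈U , f-clique) =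
  f , f-inj , U⊆U′ ∘ f∈U , λ i j i≢j → let fij∈G , cfij≡b = f-clique i j i≢j in fij∈G , recolour _ _ cfij≡b

splitAt-injective : ∀ m {k} → Injective _≡_ _≡_ (splitAt m {k})
splitAt-injective m {k} {i} {j} eq = begin
  i                    ≡⟨ join-splitAt m k i ⟨
  join m k (splitAt m i) ≡⟨ cong (join m k) eq ⟩
  join m k (splitAt m j) ≡⟨ join-splitAt m k j ⟩
  j                    ∎
  where open ≡-Reasoning

MonoClique-++ : ∀ {n} {G : Graph n} {U c b t s} →
                ((f , _) : MonoClique G U c b t) ((g , _) : MonoClique G U c b s) →
                (∀ i j → Joined G c b (f i) (g j)) → MonoClique G U c b (t + s)
MonoClique-++ {G = G} {U} {c} {b} {t} (f , f-inj , f∈U , f-clique) (g , g-inj , g∈U , g-clique) f~g =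
  f ++ g , (λ eq → splitAt-injective t ([f,g]-injective _ _ eq)) , [f,g]∈U ∘ splitAt t ,
  λ i j i≢j → [f,g]-clique _ _ (i≢j ∘ splitAt-injective t)
  where
  f≢g : ∀ i j → f i ≢ g j
  f≢g i j fi≡gj = Joined-irrefl G {c} {b} (subst (Joined G c b (f i)) (sym fi≡gj) (f~g i j))

  [f,g]-injective : ∀ a a′ → [ f , g ]′ a ≡ [ f , g ]′ a′ → a ≡ a′
  [f,g]-injective (inj₁ i) (inj₁ j) fi≡fj = cong inj₁ (f-inj fi≡fj)
  [f,g]-injective (inj₁ i) (inj₂ j) fi≡gj = ⊥-elim (f≢g i j fi≡gj)
  [f,g]-injective (inj₂ i) (inj₁ j) gi≡fj = ⊥-elim (f≢g j i (sym gi≡fj))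
  [f,g]-injective (inj₂ i) (inj₂ j) gi≡gj = cong inj₂ (g-inj gi≡gj)

  [f,g]∈U : ∀ a → [ f , g ]′ a ∈ U
  [f,g]∈U (inj₁ i) = f∈U i
  [f,g]∈U (inj₂ j) = g∈U j

  [f,g]-clique : ∀ a a′ → a ≢ a′ → Joined G c b ([ f , g ]′ a) ([ f , g ]′ a′)
  [f,g]-clique (inj₁ i) (inj₁ j) a≢a′ = f-clique i j (a≢a′ ∘ cong inj₁)
  [f,g]-clique (inj₁ i) (inj₂ j) _    = f~g i j
  [f,g]-clique (inj₂ i) (inj₁ j) _    = Joined-sym G {c} (f~g j i)
  [f,g]-clique (inj₂ i) (inj₂ j) a≢a′ = g-clique i j (a≢a′ ∘ cong inj₂)

red : ∀ {n} → Graph n → Colouring n → Fin n → Fin n → Bool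
red G c u v = adj G u v ∧ col c u v

red-sym : ∀ {n} (G : Graph n) c u v → red G c u v ≡ red G c v u
red-sym G c u v = cong₂ _∧_ (Graph.sym G u v) (colSym c u v)

T-red⇒Joined : ∀ {n} (G : Graph n) c {u v} → T (red G c u v) → Joined G c true u v
T-red⇒Joined G c {u} {v} red-uv = let uv∈G , cuv = to (T-∧ {adj G u v}) red-uv in to T-≡ uv∈G , to T-≡ cuv

invert : ∀ {n} → Colouring n → Colouring n
invert c = record { col = λ u v → not (col c u v) ; colSym = λ u v → cong not (colSym c u v) }

MonoClique-invert : ∀ {n} (G : Graph n) c {U b k} → MonoClique G U (invert c) b k → MonoClique G U c (not b) k
MonoClique-invert G c = MonoClique-map {G = G} {c = invert c} {c′ = c} id
  (λ u v not-cuv≡b → trans (sym (not-involutive (col c u v))) (cong not not-cuv≡b))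

edgeCount≤∑degree : ∀ {n} (G : Graph n) → edgeCount G ≤ ∑[ v < n ] # (λ u → adj G u v)
edgeCount≤∑degree {n} G = begin
  edgeCount G                                    ≡⟨ listSum-allFin n _ ⟩
  ∑[ u < n ] List.sum (List.map (edge? u) (List.allFin n))
                                                 ≡⟨ sum-cong-≗ {n} (λ u → listSum-allFin n (edge? u)) ⟩
  ∑[ u < n ] ∑[ v < n ] edge? u v                ≤⟨ ∑-mono-≤ (λ u → ∑-mono-≤ (edge?≤[adj] u)) ⟩
  ∑[ u < n ] ∑[ v < n ] [ adj G u v ]            ≡⟨ ∑-comm (λ u v → [ adj G u v ]) ⟩
  ∑[ v < n ] # (λ u → adj G u v)                 ∎
  where
  open ≤-Reasoning
  edge? : Fin n → Fin n → ℕ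
  edge? u v = if (toℕ u <ᵇ toℕ v) ∧ adj G u v then 1 else 0
  edge?≤[adj] : ∀ u v → edge? u v ≤ [ adj G u v ]
  edge?≤[adj] u v with toℕ u <ᵇ toℕ v | adj G u v
  ... | true  | true  = ≤-refl
  ... | true  | false = z≤n
  ... | false | _     = z≤n

m≤n+o⇒m≤2n⊎m≤2o : ∀ {m} n o → m ≤ n + o → m ≤ 2 * n ⊎ m ≤ 2 * o
m≤n+o⇒m≤2n⊎m≤2o n o m≤n+o with ≤-total o n
... | inj₁ o≤n = inj₁ (≤-trans m≤n+o (+-monoʳ-≤ n (≤-trans o≤n (m≤m+n n 0))))
... | inj₂ n≤o = inj₂ (≤-trans m≤n+o (+-mono-≤ n≤o (m≤m+n o 0)))

one-colour-dense : ∀ {n} (G : Graph n) (c : Colouring n) →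
                   edgeCount G ≤ 2 * ∑[ v < n ] # (λ u → red G c u v) ⊎
                   edgeCount G ≤ 2 * ∑[ v < n ] # (λ u → red G (invert c) u v)
one-colour-dense {n} G c = m≤n+o⇒m≤2n⊎m≤2o (sum red-degree) (sum blue-degree) e≤red+blue
  where
  red-degree blue-degree : Fin n → ℕ
  red-degree  v = # (λ u → red G c u v)
  blue-degree v = # (λ u → red G (invert c) u v)
  [a]≡[a∧b]+[a∧¬b] : ∀ a b → [ a ] ≡ [ a ∧ b ] + [ a ∧ not b ]
  [a]≡[a∧b]+[a∧¬b] true  true  = refl
  [a]≡[a∧b]+[a∧¬b] true  false = refl
  [a]≡[a∧b]+[a∧¬b] false _     = refl
  degree-split : ∀ v → # (λ u → adj G u v) ≡ red-degree v + blue-degree v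
  degree-split v = trans (sum-cong-≗ {n} λ u → [a]≡[a∧b]+[a∧¬b] (adj G u v) (col c u v))
                         (∑-distrib-+ (λ u → [ red G c u v ]) (λ u → [ red G (invert c) u v ]))
  e≤red+blue : edgeCount G ≤ sum red-degree + sum blue-degree
  e≤red+blue = ≤-trans (edgeCount≤∑degree G)
                       (≤-reflexive (trans (sum-cong-≗ {n} degree-split) (∑-distrib-+ red-degree blue-degree)))

dense-colour-power-sum : ∀ {n} (G : Graph n) (c : Colouring n) a b h → 0 < a → a * (n * n) ≤ b * edgeCount G →
                         edgeCount G ≤ 2 * ∑[ v < n ] # (λ u → red G c u v) →
                         2 * n ^ suc h ≤ 2 * (4 * b) ^ suc h * ∑[ v < n ] (# (λ u → red G c u v) ^ h)
dense-colour-power-sum {n} G c a b h 0<a an²≤be e≤2∑degree = begin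
  2 * n ^ suc h                                     ≤⟨ *-monoʳ-≤ 2 n^[1+h]≤ ⟩
  2 * ((4 * b) ^ suc h * ∑[ v < n ] (degree v ^ h)) ≡⟨ *-assoc 2 ((4 * b) ^ suc h) _ ⟨
  2 * (4 * b) ^ suc h * ∑[ v < n ] (degree v ^ h)   ∎
  where
  open ≤-Reasoning
  open CommonNeighbourhood (red G c)
  regroup : ∀ b S → 2 * (b * (2 * S)) ≡ 4 * b * S
  regroup = solve-∀
  2n²≤4b∑degree : 2 * (n * n) ≤ 4 * b * sum degree
  2n²≤4b∑degree = begin
    2 * (n * n)                ≤⟨ *-monoʳ-≤ 2 (m≤n*m (n * n) a {{>-nonZero 0<a}}) ⟩
    2 * (a * (n * n))          ≤⟨ *-monoʳ-≤ 2 an²≤be ⟩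
    2 * (b * edgeCount G)      ≤⟨ *-monoʳ-≤ 2 (*-monoʳ-≤ b e≤2∑degree) ⟩
    2 * (b * (2 * sum degree)) ≡⟨ regroup b (sum degree) ⟩
    4 * b * sum degree         ∎
  n^[1+h]≤ : n ^ suc h ≤ (4 * b) ^ suc h * ∑[ v < n ] (degree v ^ h)
  n^[1+h]≤ = power-sum-lower-bound n (4 * b) h degree degree≤n 2n²≤4b∑degree

-- Dependent random choice

module DependentRandomChoice {n} .{{_ : NonZero n}} (G : Graph n) (c : Colouring n) (p q t d : ℕ)
  (1≤p : 1 ≤ p) (d<n : d < n)
  (dense : 2 * n ^ suc (q * t) ≤ d * ∑[ v < n ] (CommonNeighbourhood.degree (red G c) v ^ (q * t))) where

  open CommonNeighbourhood (red G c)

  h : ℕ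
  h = q * t

  -- |N y| < n^(1-ε) with ε = p/q, raised to the q-th power.
  sparse : ∀ {k} → Vec (Fin n) k → Bool
  sparse y = # N y ^ q * n ^ p <ᵇ n ^ q

  sparse-in : Vec (Fin n) h → ℕ
  sparse-in x = ∑ᵗ t (λ y → [ sparse y ∧ all (N x) y ])

  ∅-not-sparse : ∀ (y : Vec (Fin n) t) → T (all (λ _ → false) y) → ¬ T (sparse y)
  ∅-not-sparse [] _ sparse[] = <⇒≱ (<ᵇ⇒< _ _ sparse[]) (begin
    n ^ q               ≤⟨ m≤m*n (n ^ q) (n ^ p) {{m^n≢0 n p}} ⟩
    n ^ q * n ^ p       ≡⟨ cong (λ m → m ^ q * n ^ p) #N[]≡n ⟨
    # N [] ^ q * n ^ p  ∎)
    where open ≤-Reasoning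

  sparse-weight : ∀ (y : Vec (Fin n) t) → n ^ (p * t) * ([ sparse y ] * # N y ^ h) ≤ n ^ h
  sparse-weight y with sparse y in sparse-y
  ... | false = subst (_≤ n ^ h) (sym (*-zeroʳ (n ^ (p * t)))) z≤n
  ... | true  = begin
    n ^ (p * t) * (1 * # N y ^ (q * t)) ≡⟨ cong (n ^ (p * t) *_) (*-identityˡ _) ⟩
    n ^ (p * t) * # N y ^ (q * t)       ≡⟨ cong₂ _*_ (^-*-assoc n p t) (^-*-assoc (# N y) q t) ⟨
    (n ^ p) ^ t * (# N y ^ q) ^ t       ≡⟨ ^-distribʳ-* (n ^ p) (# N y ^ q) t ⟨
    (n ^ p * # N y ^ q) ^ t             ≤⟨ ^-monoˡ-≤ t (subst (_≤ n ^ q) (*-comm (# N y ^ q) (n ^ p)) small) ⟩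
    (n ^ q) ^ t                         ≡⟨ ^-*-assoc n q t ⟩
    n ^ (q * t)                         ∎
    where
    open ≤-Reasoning
    small : # N y ^ q * n ^ p ≤ n ^ q
    small = <⇒≤ (<ᵇ⇒< _ _ (subst T (sym sparse-y) _))

  ∑ᵗ-sparse-in : ∑ᵗ h sparse-in ≤ n ^ h
  ∑ᵗ-sparse-in = *-cancelˡ-≤ (n ^ (p * t)) {{m^n≢0 n (p * t)}} (begin
    n ^ (p * t) * ∑ᵗ h sparse-in                           ≡⟨ cong (n ^ (p * t) *_) ∑ᵗ-sparse-in≡ ⟩
    n ^ (p * t) * ∑ᵗ t (λ y → [ sparse y ] * # N y ^ h)   ≡⟨ *-distribˡ-∑ᵗ t (n ^ (p * t)) _ ⟩
    ∑ᵗ t (λ y → n ^ (p * t) * ([ sparse y ] * # N y ^ h)) ≤⟨ ∑ᵗ-mono-≤ t sparse-weight ⟩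
    ∑ᵗ t (λ _ → n ^ h)                                     ≡⟨ ∑ᵗ-const t (n ^ h) ⟩
    n ^ t * n ^ h                                          ≤⟨ *-monoˡ-≤ (n ^ h) (^-monoʳ-≤ n t≤p*t) ⟩
    n ^ (p * t) * n ^ h                                    ∎)
    where
    open ≤-Reasoning
    ∑ᵗ-sparse-in≡ : ∑ᵗ h sparse-in ≡ ∑ᵗ t (λ y → [ sparse y ] * # N y ^ h)
    ∑ᵗ-sparse-in≡ = ∑ᵗ-count-in-N (red-sym G c) h t sparse
    t≤p*t : t ≤ p * t
    t≤p*t = m≤n*m t p {{>-nonZero 1≤p}}

  few-sparse-tuples : ∃ λ x → n + d * sparse-in x < d * # N x
  few-sparse-tuples = ∑ᵗ-<⇒∃< h (λ x → n + d * sparse-in x) (λ x → d * # N x) (begin-strict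
    ∑ᵗ h (λ x → n + d * sparse-in x)          ≡⟨ ∑ᵗ-distrib-+ h (λ _ → n) (λ x → d * sparse-in x) ⟩
    ∑ᵗ h (λ _ → n) + ∑ᵗ h (λ x → d * sparse-in x)
                                              ≡⟨ cong₂ _+_ (∑ᵗ-const h n) (sym (*-distribˡ-∑ᵗ h d sparse-in)) ⟩
    n ^ h * n + d * ∑ᵗ h sparse-in            ≤⟨ +-monoʳ-≤ (n ^ h * n) (*-monoʳ-≤ d ∑ᵗ-sparse-in) ⟩
    n ^ h * n + d * n ^ h                     <⟨ +-monoʳ-< (n ^ h * n) (*-monoˡ-< (n ^ h) {{m^n≢0 n h}} d<n) ⟩
    n ^ h * n + n * n ^ h                     ≡⟨ cong₂ _+_ (*-comm (n ^ h) n) (sym (+-identityʳ (n * n ^ h))) ⟩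
    2 * n ^ suc h                             ≤⟨ dense ⟩
    d * ∑[ v < n ] (degree v ^ h)             ≡⟨ cong (d *_) (∑ᵗ-#N h) ⟨
    d * ∑ᵗ h (λ x → # N x)                    ≡⟨ *-distribˡ-∑ᵗ h d (λ x → # N x) ⟩
    ∑ᵗ h (λ x → d * # N x)                    ∎)
    where open ≤-Reasoning

  large-sparse-free-set : Σ (Fin n → Bool) λ A →
                            n ≤ d * ∣ tabulate A ∣ × (∀ y → T (all A y) → ¬ T (sparse y))
  large-sparse-free-set with few-sparse-tuples
  ... | x , n+d*sparse<d*#N with delete-bad-tuples t sparse ∅-not-sparse (N x)
  ...   | A , #N≤#A+sparse , A-sparse-free = A , A-large , A-sparse-free
    where
    A-large : n ≤ d * ∣ tabulate A ∣
    A-large = subst (λ a → n ≤ d * a) (sym (∣tabulate∣≡# A)) (<⇒≤ (+-cancelʳ-< (d * sparse-in x) n (d * # A) n+d*sparse<))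
      where
      open ≤-Reasoning
      n+d*sparse< : n + d * sparse-in x < d * # A + d * sparse-in x
      n+d*sparse< = begin-strict
        n + d * sparse-in x          <⟨ n+d*sparse<d*#N ⟩
        d * # N x                    ≤⟨ *-monoʳ-≤ d #N≤#A+sparse ⟩
        d * (# A + sparse-in x)      ≡⟨ *-distribˡ-+ d (# A) (sparse-in x) ⟩
        d * # A + d * sparse-in x    ∎

  within-⊤ : ∀ {U b k} → MonoClique G U c b k → MonoClique G ⊤ c b k
  within-⊤ = MonoClique-map {G = G} {c = c} {c′ = c} (λ _ → ∈⊤) (λ _ _ → id)

  extend-clique : ∀ {s r} → (∀ U → n ^ q ≤ ∣ U ∣ ^ q * n ^ p → Arrows G U s r) →
                  (A : Fin n → Bool) → (∀ y → T (all A y) → ¬ T (sparse y)) →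
                  MonoClique G (tabulate A) c true t →
                  MonoClique G ⊤ c true (t + s) ⊎ MonoClique G ⊤ c false r
  extend-clique medium-arrows A A-sparse-free K@(f , _ , f∈A , _) =
    [ (λ L → inj₁ (MonoClique-++ {G = G} {c = c} (within-⊤ K) (within-⊤ L) (f~g L)))
    , inj₂ ∘ within-⊤
    ]′ (medium-arrows (tabulate (N (tabulate f))) N-medium c)
    where
    f-not-sparse : ¬ T (sparse (tabulate f))
    f-not-sparse = A-sparse-free (tabulate f) (all-tabulate⁺ A f (λ i → ∈tabulate⇒T A (f∈A i)))

    N-medium : n ^ q ≤ ∣ tabulate (N (tabulate f)) ∣ ^ q * n ^ p
    N-medium = subst (λ m → n ^ q ≤ m ^ q * n ^ p) (sym (∣tabulate∣≡# (N (tabulate f))))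
                     (≮⇒≥ (f-not-sparse ∘ <⇒<ᵇ))

    f~g : ∀ {s} ((g , _) : MonoClique G (tabulate (N (tabulate f))) c true s) →
          ∀ i j → Joined G c true (f i) (g j)
    f~g (g , _ , g∈N , _) i j =
      T-red⇒Joined G c (all-tabulate⁻ (λ u → red G c u (g j)) f (∈tabulate⇒T (N (tabulate f)) (g∈N j)) i)

  red-or-blue-clique : ∀ {s r} → (∀ U → n ≤ d * ∣ U ∣ → Arrows G U t r) →
                       (∀ U → n ^ q ≤ ∣ U ∣ ^ q * n ^ p → Arrows G U s r) →
                       MonoClique G ⊤ c true (t + s) ⊎ MonoClique G ⊤ c false r
  red-or-blue-clique large-arrows medium-arrows with large-sparse-free-set
  ... | A , A-large , A-sparse-free =
    [ extend-clique medium-arrows A A-sparse-free , inj₂ ∘ within-⊤ ]′ (large-arrows (tabulate A) A-large c)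

Arrows-of-dense-graph : ∀ {n} (G : Graph n) a b p q t s r d → t + s ≡ r → 0 < a → 1 ≤ p →
                        2 * (4 * b) ^ suc (q * t) ≤ d → d < n → a * (n * n) ≤ b * edgeCount G →
                        (∀ U → n ≤ d * ∣ U ∣ → Arrows G U t r) →
                        (∀ U → n ^ q ≤ ∣ U ∣ ^ q * n ^ p → Arrows G U s r) →
                        Arrows G ⊤ r r
Arrows-of-dense-graph {n} G a b p q t s r d t+s≡r 0<a 1≤p d-large d<n dense large medium c =
  [ clique c , swap ∘ map (MonoClique-invert G c) (MonoClique-invert G c) ∘ clique (invert c) ]′
    (one-colour-dense G c)
  where
  clique : ∀ c′ → edgeCount G ≤ 2 * ∑[ v < n ] # (λ u → red G c′ u v) →
           MonoClique G ⊤ c′ true r ⊎ MonoClique G ⊤ c′ false r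
  clique c′ c′-dense = map₁ (subst (MonoClique G ⊤ c′ true) t+s≡r)
    (DependentRandomChoice.red-or-blue-clique {{>-nonZero (≤-<-trans z≤n d<n)}} G c′ p q t d 1≤p d<n
      power-sum-bound large medium)
    where
    power-sum-bound : 2 * n ^ suc (q * t) ≤ d * ∑[ v < n ] (# (λ u → red G c′ u v) ^ (q * t))
    power-sum-bound = ≤-trans (dense-colour-power-sum G c′ a b (q * t) 0<a dense c′-dense) (*-monoˡ-≤ _ d-large)

lemma3p4 : (a b p q r : ℕ) → 0 < a → 0 < b → 0 < p → 0 < q →
    Σ ℕ λ c → Σ ℕ λ d → Σ ℕ λ n₀ → 0 < c × 0 < d ×
      ((n : ℕ) → n₀ ≤ n → (G : Graph n) →
        a * (n * n) ≤ b * edgeCount G →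
        ((U : Subset n) → c * n ≤ d * ∣ U ∣ → Arrows G U ⌈ r /2⌉ r) →
        ((U : Subset n) → n ^ q ≤ (∣ U ∣ ^ q) * (n ^ p) → Arrows G U ⌊ r /2⌋ r) →
        Arrows G ⊤ r r)
lemma3p4 a b p q r 0<a 0<b 0<p _ = 1 , d , suc d , s≤s z≤n , 0<d ,
  λ n d<n G dense large medium →
    Arrows-of-dense-graph G a b p q ⌈ r /2⌉ ⌊ r /2⌋ r d ⌈r/2⌉+⌊r/2⌋≡r 0<a 0<p ≤-refl d<n dense
      (λ U → large U ∘ subst (_≤ d * ∣ U ∣) (sym (*-identityˡ n))) medium
  where
  d : ℕ
  d = 2 * (4 * b) ^ suc (q * ⌈ r /2⌉)
  0<d : 0 < d
  0<d = ≤-trans (m^n>0 (4 * b) {{m*n≢0 4 b {{_}} {{>-nonZero 0<b}}}} (suc (q * ⌈ r /2⌉))) (m≤n*m _ 2)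
  ⌈r/2⌉+⌊r/2⌋≡r : ⌈ r /2⌉ + ⌊ r /2⌋ ≡ r
  ⌈r/2⌉+⌊r/2⌋≡r = trans (+-comm ⌈ r /2⌉ ⌊ r /2⌋) (⌊n/2⌋+⌈n/2⌉≡n r)
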